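{- Let $\beta$ be a periodic semi-infinite string and let $k\in[1,\mathrm{period}(\beta)]$ be an integer such that $|\mathrm{ov}(s,\beta[k])|<\mathrm{period}(s)+\tfrac12\mathrm{period}(\beta)$ for every finite string $s$ inequivalent to $\beta$. Then for every integer $k'\in[0,k)$ and every finite string $s$ inequivalent to $\beta$, $$|\mathrm{ov}(s,\beta[k-k'])|<\mathrm{period}(s)+\tfrac12\mathrm{period}(\beta)+k'.$$
   Context: A semi-infinite string is an infinite sequence of characters; it is periodic if it equals $x^\infty=xxx\cdots$ for some finite nonempty string $x$; $\mathrm{pref}(\beta,\beta)$ denotes the shortest such $x$ and $\mathrm{period}(\beta)=|\mathrm{pref}(\beta,\beta)|$. For $k\ge1$, $\beta[k]$ is the semi-infinite suffix of $\beta$ starting at its $k$-th character. For a finite string $s$: $\mathrm{ov}(s,s)$ is the longest suffix of $s$ of length less than $|s|$ that is also a prefix of $s$, $s=\mathrm{pref}(s,s)\mathrm{ov}(s,s)$ and $\mathrm{period}(s)=|\mathrm{pref}(s,s)|$. For a finite string $s$ and a (finite or semi-infinite) string $t$, $\mathrm{ov}(s,t)$ is the longest suffix of $s$ that is a prefix of $t$. A finite string $s$ and $\beta$ are equivalent if $\mathrm{pref}(\beta,\beta)$ is a rotation of $\mathrm{pref}(s,s)$ (i.e. $\mathrm{pref}(s,s)=xy$ and $\mathrm{pref}(\beta,\beta)=yx$ for some possibly empty $x,y$), and inequivalent otherwise. (By the Overlap Rotation Lemma of Breslauer–Jiang–Jiang, such a $k$ always exists.) -}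

module Defs where

open import Data.Nat using (ℕ; zero; suc; _+_; _∸_; _≤_; _<_)
open import Data.List using (List; []; _∷_; length; drop; take; _++_)
open import Data.List.Properties using (≡-dec)
open import Data.Product using (Σ; ∃; ∃-syntax; _×_; _,_)
open import Data.Bool using (if_then_else_)
open import Relation.Nullary.Decidable using (⌊_⌋)
open import Relation.Binary.Definitions using (DecidableEquality)
open import Relation.Binary.PropositionalEquality using (_≡_)

SemiInf : Set → Set
SemiInf A = ℕ → A

takeS : {A : Set} → ℕ → SemiInf A → List A
takeS zero    t = []
takeS (suc n) t = t 0 ∷ takeS n (λ i → t (suc i))

-- β[k] : suffix starting at the k-th character (1-indexed, k ≥ 1)
suffixAt : {A : Set} → SemiInf A → ℕ → SemiInf A
suffixAt β k = λ i → β (i + (k ∸ 1))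

HasPeriod : {A : Set} → SemiInf A → ℕ → Set
HasPeriod β q = 1 ≤ q × (∀ i → β (i + q) ≡ β i)

Periodic : {A : Set} → SemiInf A → Set
Periodic β = ∃[ q ] HasPeriod β q

IsPeriodOf : {A : Set} → SemiInf A → ℕ → Set
IsPeriodOf β p = HasPeriod β p × (∀ q → HasPeriod β q → p ≤ q)

prefInf : {A : Set} → SemiInf A → ℕ → List A
prefInf β p = takeS p β

module _ {A : Set} (_≟_ : DecidableEquality A) where

  -- largest l ≤ n with P l (P 0 assumed / default 0)
  private
    search : (ℕ → List A) → (ℕ → List A) → ℕ → ℕ
    search suf pre zero    = zero
    search suf pre (suc l) =
      if ⌊ ≡-dec _≟_ (suf (suc l)) (pre (suc l)) ⌋ then suc l else search suf pre l

  -- |ov(s,t)| : length of the longest suffix of s that is a prefix of t (t semi-infinite)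
  ovInf : List A → SemiInf A → ℕ
  ovInf s t = search (λ l → drop (length s ∸ l) s) (λ l → takeS l t) (length s)

  -- |ov(s,s)| : longest suffix of s of length < |s| that is also a prefix of s
  ovSelf : List A → ℕ
  ovSelf s = search (λ l → drop (length s ∸ l) s) (λ l → take l s) (length s ∸ 1)

  -- period(s) = |pref(s,s)| where s = pref(s,s) ov(s,s)
  periodFin : List A → ℕ
  periodFin s = length s ∸ ovSelf s

  prefFin : List A → List A
  prefFin s = take (periodFin s) s

  Equivalent : List A → SemiInf A → ℕ → Set
  Equivalent s β p = ∃[ x ] ∃[ y ] (prefFin s ≡ x ++ y × prefInf β p ≡ y ++ x)

-- The overlap of s with a string moves by at most one per character when the
-- string is shifted: if the suffix of s of length L is a prefix of u, and t is u
-- with its first k′ characters removed, then the suffix of s of length L ∸ k′ is a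
-- prefix of t, so ov(s,u) ≤ ov(s,t) + k′.  Taking u = β[k−k′] and t = β[k] turns
-- the bound at k into the bound at k − k′.
module Submission where

open import Defs
open import Data.Nat using (ℕ; zero; suc; _+_; _*_; _∸_; _≤_; _<_; z≤n; s≤s; s≤s⁻¹)
open import Data.Nat.Properties
open import Data.List using (List; _∷_; length; drop)
open import Data.List.Properties using (≡-dec; drop-drop; drop-all)
open import Data.Bool using (if_then_else_)
open import Data.Product using (_,_)
open import Data.Sum using (inj₁; inj₂)
open import Level using (0ℓ)
open import Relation.Nullary using (¬_; yes; no; contradiction)
open import Relation.Nullary.Decidable using (⌊_⌋)
open import Relation.Unary using (Pred; Decidable; _≐_)
open import Relation.Binary.Definitions using (DecidableEquality)
open import Relation.Binary.PropositionalEquality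

record GreatestUpTo (P : Pred ℕ 0ℓ) (n r : ℕ) : Set where
  field
    bounded  : r ≤ n
    holds    : P r
    greatest : ∀ {l} → l ≤ n → P l → l ≤ r

GreatestUpTo-resp : ∀ {P Q : Pred ℕ 0ℓ} {n r} → P ≐ Q → GreatestUpTo P n r → GreatestUpTo Q n r
GreatestUpTo-resp (P⊆Q , Q⊆P) g = record
  { bounded = bounded ; holds = P⊆Q holds ; greatest = λ l≤n Ql → greatest l≤n (Q⊆P Ql) }
  where open GreatestUpTo g

module _ {P : Pred ℕ 0ℓ} (P? : Decidable P) where

  search-greatest : (f : ℕ → ℕ) → f 0 ≡ 0 →
    (∀ m → f (suc m) ≡ (if ⌊ P? (suc m) ⌋ then suc m else f m)) →
    P 0 → ∀ n → GreatestUpTo P n (f n)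
  search-greatest f f0 fsuc P0 zero = subst (GreatestUpTo P 0) (sym f0) record
    { bounded = z≤n ; holds = P0 ; greatest = λ { z≤n _ → z≤n } }
  search-greatest f f0 fsuc P0 (suc m) with P? (suc m) | fsuc m
  ... | yes P[1+m] | f[1+m]≡1+m = subst (GreatestUpTo P (suc m)) (sym f[1+m]≡1+m) record
    { bounded = ≤-refl ; holds = P[1+m] ; greatest = λ l≤1+m _ → l≤1+m }
  ... | no ¬P[1+m] | f[1+m]≡fm = subst (GreatestUpTo P (suc m)) (sym f[1+m]≡fm) record
    { bounded = m≤n⇒m≤1+n bounded ; holds = holds ; greatest = greatest′ }
    where
    open GreatestUpTo (search-greatest f f0 fsuc P0 m)
    greatest′ : ∀ {l} → l ≤ suc m → P l → l ≤ f m
    greatest′ l≤1+m Pl with m≤n⇒m<n∨m≡n l≤1+m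
    ... | inj₁ l<1+m = greatest (s≤s⁻¹ l<1+m) Pl
    ... | inj₂ refl  = contradiction Pl ¬P[1+m]

takeS-cong : ∀ {A : Set} n {u t : SemiInf A} → (∀ i → u i ≡ t i) → takeS n u ≡ takeS n t
takeS-cong zero    u≗t = refl
takeS-cong (suc n) u≗t = cong₂ _∷_ (u≗t 0) (takeS-cong n (λ i → u≗t (suc i)))

drop-takeS : ∀ {A : Set} m n (t : SemiInf A) → drop m (takeS n t) ≡ takeS (n ∸ m) (λ i → t (i + m))
drop-takeS zero    n       t = takeS-cong n (λ i → cong t (sym (+-identityʳ i)))
drop-takeS (suc m) zero    t = refl
drop-takeS (suc m) (suc n) t =
  trans (drop-takeS m n (λ i → t (suc i))) (takeS-cong (n ∸ m) (λ i → cong t (sym (+-suc i m))))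

Overlap : {A : Set} → List A → SemiInf A → ℕ → Set
Overlap s t l = drop (length s ∸ l) s ≡ takeS l t

m∸n≡m∸[n+o]+o : ∀ {m} n o → n + o ≤ m → m ∸ n ≡ m ∸ (n + o) + o
m∸n≡m∸[n+o]+o {m} n o n+o≤m = begin
  m ∸ n             ≡⟨ m∸n+n≡m (m+n≤o⇒m≤o∸n o (≤-trans (≤-reflexive (+-comm o n)) n+o≤m)) ⟨
  m ∸ n ∸ o + o     ≡⟨ cong (_+ o) (∸-+-assoc m n o) ⟩
  m ∸ (n + o) + o   ∎
  where open ≡-Reasoning

overlap-shift : ∀ {A : Set} (s : List A) (u : SemiInf A) l k′ → l + k′ ≤ length s →
  Overlap s u (l + k′) → Overlap s (λ i → u (i + k′)) l
overlap-shift s u l k′ l+k′≤len match = begin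
  drop (length s ∸ l) s                     ≡⟨ cong (λ n → drop n s) (m∸n≡m∸[n+o]+o l k′ l+k′≤len) ⟩
  drop (length s ∸ (l + k′) + k′) s         ≡⟨ drop-drop (length s ∸ (l + k′)) k′ s ⟨
  drop k′ (drop (length s ∸ (l + k′)) s)    ≡⟨ cong (drop k′) match ⟩
  drop k′ (takeS (l + k′) u)                ≡⟨ drop-takeS k′ (l + k′) u ⟩
  takeS (l + k′ ∸ k′) (λ i → u (i + k′))    ≡⟨ cong (λ n → takeS n (λ i → u (i + k′))) (m+n∸n≡m l k′) ⟩
  takeS l (λ i → u (i + k′))                ∎
  where open ≡-Reasoning

module _ {A : Set} (_≟_ : DecidableEquality A) where

  -- The search behind ovInf is private to Defs; abstracting the suffix map and then
  -- length s lets Agda infer it as the f of search-greatest.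
  ovInf-greatest : ∀ s t → GreatestUpTo (Overlap s t) (length s) (ovInf _≟_ s t)
  ovInf-greatest s t with (λ l → drop {A = A} (length s ∸ l) s) in S≡
  ... | S with length s in len≡n | search-greatest (λ l → ≡-dec _≟_ (S l) (takeS l t)) _ refl (λ _ → refl)
                                     (trans (sym (cong-app S≡ 0)) (drop-all (length s) s ≤-refl))
  ... | n | greatest = GreatestUpTo-resp (trans (sym (S≡drop _)) , trans (S≡drop _)) (greatest n)
    where
    S≡drop : ∀ l → S l ≡ drop (n ∸ l) s
    S≡drop l = trans (sym (cong-app S≡ l)) (cong (λ m → drop (m ∸ l) s) len≡n)

  ovInf-shift : ∀ s (u t : SemiInf A) k′ → (∀ i → u (i + k′) ≡ t i) →
    ovInf _≟_ s u ≤ ovInf _≟_ s t + k′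
  ovInf-shift s u t k′ shift with ovInf _≟_ s u ≤? k′
  ... | yes L≤k′ = ≤-trans L≤k′ (m≤n+m k′ _)
  ... | no L≰k′ = begin
    L                   ≡⟨ m∸n+n≡m k′≤L ⟨
    L ∸ k′ + k′         ≤⟨ +-monoˡ-≤ k′ (greatest (≤-trans (m∸n≤m L k′) bounded) match) ⟩
    ovInf _≟_ s t + k′  ∎
    where
    open ≤-Reasoning
    open GreatestUpTo (ovInf-greatest s u) using (bounded; holds)
    open GreatestUpTo (ovInf-greatest s t) using (greatest)
    L : ℕ
    L = ovInf _≟_ s u
    k′≤L : k′ ≤ L
    k′≤L = <⇒≤ (≰⇒> L≰k′)
    match : Overlap s t (L ∸ k′)
    match = trans
      (overlap-shift s u (L ∸ k′) k′ (≤-trans (≤-reflexive (m∸n+n≡m k′≤L)) bounded)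
        (subst (Overlap s u) (sym (m∸n+n≡m k′≤L)) holds))
      (takeS-cong (L ∸ k′) shift)

suffixAt-shift : ∀ {A : Set} (β : SemiInf A) {k k′} → k′ < k →
  ∀ i → suffixAt β (k ∸ k′) (i + k′) ≡ suffixAt β k i
suffixAt-shift β {suc j} {k′} (s≤s k′≤j) i = cong β (begin
  i + k′ + (suc j ∸ k′ ∸ 1)  ≡⟨ cong (λ n → i + k′ + (n ∸ 1)) (+-∸-assoc 1 k′≤j) ⟩
  i + k′ + (j ∸ k′)          ≡⟨ +-assoc i k′ (j ∸ k′) ⟩
  i + (k′ + (j ∸ k′))        ≡⟨ cong (i +_) (m+[n∸m]≡n k′≤j) ⟩
  i + j                      ∎)
  where open ≡-Reasoning

lemma11 : {A : Set} (_≟_ : DecidableEquality A) (β : SemiInf A) (p : ℕ) →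
    Periodic β → IsPeriodOf β p →
    (k : ℕ) → 1 ≤ k → k ≤ p →
    (∀ (s : List A) → ¬ Equivalent _≟_ s β p →
       2 * ovInf _≟_ s (suffixAt β k) < 2 * periodFin _≟_ s + p) →
    ∀ (k′ : ℕ) → k′ < k → ∀ (s : List A) → ¬ Equivalent _≟_ s β p →
      2 * ovInf _≟_ s (suffixAt β (k ∸ k′)) < 2 * periodFin _≟_ s + p + 2 * k′
lemma11 _≟_ β p _ _ k _ _ bound-at-k k′ k′<k s s≁β = begin-strict
  2 * ovInf _≟_ s (suffixAt β (k ∸ k′))  ≤⟨ *-monoʳ-≤ 2 ov-shift ⟩
  2 * (ovInf _≟_ s (suffixAt β k) + k′)  ≡⟨ *-distribˡ-+ 2 (ovInf _≟_ s (suffixAt β k)) k′ ⟩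
  2 * ovInf _≟_ s (suffixAt β k) + 2 * k′ <⟨ +-monoˡ-< (2 * k′) (bound-at-k s s≁β) ⟩
  2 * periodFin _≟_ s + p + 2 * k′        ∎
  where
  open ≤-Reasoning
  ov-shift : ovInf _≟_ s (suffixAt β (k ∸ k′)) ≤ ovInf _≟_ s (suffixAt β k) + k′
  ov-shift = ovInf-shift _≟_ s (suffixAt β (k ∸ k′)) (suffixAt β k) k′ (suffixAt-shift β k′<k)
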